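{- Let $(\alpha,\beta,\gamma)\in\mathbb{Z}[i]^3$ satisfy $\alpha^2+i\beta^2+\gamma^2=0$, $\alpha\beta\gamma\neq0$, $\gcd(\alpha,\beta,\gamma)\in U$, and suppose $\beta\equiv 0\pmod{(1+i)^2}$. Suppose $\alpha=i^m\alpha'$, $\beta=i^n(1+i)^{2+k}\beta'$, $\gamma=i^l\gamma'$, where $m,n,l\in\{0,1\}$, $k\ge0$ is an integer, and $\alpha',\beta',\gamma'\in O^I$. Then $m+l\equiv 1\pmod 2$.
   Context: $\mathbb{Z}[i]$ is the ring of Gaussian integers and $U=\{1,-1,i,-i\}$ its unit group. For $\alpha\in\mathbb{Z}[i]$, $R(\alpha)$ and $I(\alpha)$ denote its real and imaginary parts. $O^I=\{\alpha\in\mathbb{Z}[i]: R(\alpha)+I(\alpha)\equiv 1 \pmod 2,\ R(\alpha)\equiv 1 \pmod 4\}$. Congruences modulo $\mu$ mean divisibility by $\mu$ in $\mathbb{Z}[i]$; "$\gcd\in U$" means no common non-unit divisor. -}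

module Defs where

open import Data.Nat as ℕ using (ℕ; zero; suc)
open import Data.Integer as ℤ using (ℤ; +_; -_)
open import Data.Integer.Divisibility as ℤD using ()
open import Data.Product using (Σ; ∃; _×_; _,_)
open import Data.Sum using (_⊎_)
open import Relation.Binary.PropositionalEquality using (_≡_; _≢_)
open import Relation.Nullary using (¬_)

record ℤ[i] : Set where
  constructor _+_i
  field
    R : ℤ
    I : ℤ
open ℤ[i] public

infixl 6 _⊕_
infixl 7 _⊗_

_⊕_ : ℤ[i] → ℤ[i] → ℤ[i]
(a + b i) ⊕ (c + d i) = (a ℤ.+ c) + (b ℤ.+ d) i

_⊗_ : ℤ[i] → ℤ[i] → ℤ[i]
(a + b i) ⊗ (c + d i) = (a ℤ.* c ℤ.- b ℤ.* d) + (a ℤ.* d ℤ.+ b ℤ.* c) i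

𝟘 𝟙 𝕚 1+i : ℤ[i]
𝟘 = (+ 0) + (+ 0) i
𝟙 = (+ 1) + (+ 0) i
𝕚 = (+ 0) + (+ 1) i
1+i = (+ 1) + (+ 1) i

_^_ : ℤ[i] → ℕ → ℤ[i]
x ^ zero = 𝟙
x ^ suc n = x ⊗ (x ^ n)

_∣_ : ℤ[i] → ℤ[i] → Set
δ ∣ α = ∃ λ κ → α ≡ δ ⊗ κ

_∈U : ℤ[i] → Set
u ∈U = (u ≡ 𝟙) ⊎ (u ≡ (- + 1) + (+ 0) i) ⊎ (u ≡ 𝕚) ⊎ (u ≡ (+ 0) + (- + 1) i)

GcdInU : ℤ[i] → ℤ[i] → ℤ[i] → Set
GcdInU α β γ = ∀ δ → δ ∣ α → δ ∣ β → δ ∣ γ → δ ∈U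

O^I : ℤ[i] → Set
O^I α = (+ 2 ℤD.∣ (R α ℤ.+ I α ℤ.- + 1)) × (+ 4 ℤD.∣ (R α ℤ.- + 1))

{-# OPTIONS --safe #-}
module Submission where

-- Read α² + iβ² + γ² = 0 on real parts modulo 4.  Since α' ∈ O^I is odd + even·i,
-- R(α'²) = odd² − even² ≡ 1, and multiplying by i negates the real part of a square,
-- so R(α²) ≡ (−1)^m and likewise R(γ²) ≡ (−1)^l.  As (1+i)² = 2i divides β,
-- iβ² ∈ 4ℤ[i].  If m ≡ l (mod 2) the real part would therefore be ±2 (mod 4), not 0.

open import Defs
open import Data.Nat using (ℕ; _≤_; _%_; z≤n; s≤s)
open import Data.Nat using () renaming (_+_ to _+ℕ_)
import Data.Nat.Divisibility as ℕ
open import Data.Integer using (ℤ; +_; -_; _*_; _-_; _+_)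
import Data.Integer.Properties as ℤ
import Data.Integer.Divisibility.Signed as ℤ
open import Data.Integer.Tactic.RingSolver using (solve-∀)
open import Data.Product using (∃₂; _×_; _,_)
open import Data.Empty using (⊥-elim)
open import Relation.Nullary using (¬_)
open import Relation.Binary.PropositionalEquality
  using (_≡_; _≢_; refl; sym; trans; cong; cong₂; subst; module ≡-Reasoning)

infix 4 _≡₄_

data _≡₄_ (x r : ℤ) : Set where
  mod4 : (q : ℤ) → x ≡ r + q * + 4 → x ≡₄ r

≡₄-+ : ∀ {x y r s} → x ≡₄ r → y ≡₄ s → x + y ≡₄ r + s
≡₄-+ {r = r} {s} (mod4 p refl) (mod4 q refl) = mod4 (p + q) (shuffle r s p q)
  where
  shuffle : ∀ r s p q → (r + p * + 4) + (s + q * + 4) ≡ (r + s) + (p + q) * + 4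
  shuffle = solve-∀

≡₄-neg : ∀ {x r} → x ≡₄ r → - x ≡₄ - r
≡₄-neg {r = r} (mod4 q refl) = mod4 (- q) (negate r q)
  where
  negate : ∀ r q → - (r + q * + 4) ≡ - r + (- q) * + 4
  negate = solve-∀

2≢4q : ∀ q → + 2 ≢ q * + 4
2≢4q q 2≡4q with ℕ.∣⇒≤ (ℤ.∣⇒∣ᵤ (ℤ.divides q 2≡4q))
... | s≤s (s≤s ())

0≢₄2 : ¬ (+ 0 ≡₄ + 2)
0≢₄2 (mod4 q 0≡2+4q) = 2≢4q (- q) (begin
  + 2                             ≡⟨ cancel q ⟩
  (+ 2 + q * + 4) + (- q) * + 4   ≡⟨ cong (_+ (- q) * + 4) 0≡2+4q ⟨
  + 0 + (- q) * + 4               ≡⟨ ℤ.+-identityˡ ((- q) * + 4) ⟩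
  (- q) * + 4                     ∎)
  where
  open ≡-Reasoning
  cancel : ∀ q → + 2 ≡ (+ 2 + q * + 4) + (- q) * + 4
  cancel = solve-∀

0≢₄-2 : ¬ (+ 0 ≡₄ - + 2)
0≢₄-2 0≡₄-2 = 0≢₄2 (≡₄-neg {r = - + 2} 0≡₄-2)

𝟙-identityˡ : ∀ x → 𝟙 ⊗ x ≡ x
𝟙-identityˡ (a + b i) = cong₂ _+_i (real a b) (imag a b)
  where
  real : ∀ a b → + 1 * a - + 0 * b ≡ a
  real = solve-∀
  imag : ∀ a b → + 1 * b + + 0 * a ≡ b
  imag = solve-∀

𝕚-rotate : ∀ a b → 𝕚 ⊗ (a + b i) ≡ (- b) + a i
𝕚-rotate a b = cong₂ _+_i (real a b) (imag a b)
  where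
  real : ∀ a b → + 0 * a - + 1 * b ≡ - b
  real = solve-∀
  imag : ∀ a b → + 0 * b + + 1 * a ≡ a
  imag = solve-∀

R-𝕚⊗ : ∀ x → R (𝕚 ⊗ x) ≡ - I x
R-𝕚⊗ (a + b i) = cong R (𝕚-rotate a b)

R-square-𝟙⊗ : ∀ x → R ((𝟙 ⊗ x) ⊗ (𝟙 ⊗ x)) ≡ R (x ⊗ x)
R-square-𝟙⊗ x = cong (λ y → R (y ⊗ y)) (𝟙-identityˡ x)

R-square-𝕚⊗ : ∀ x → R ((𝕚 ⊗ x) ⊗ (𝕚 ⊗ x)) ≡ - R (x ⊗ x)
R-square-𝕚⊗ (a + b i) = trans (cong (λ y → R (y ⊗ y)) (𝕚-rotate a b)) (square a b)
  where
  square : ∀ a b → (- b) * (- b) - a * a ≡ - (a * a - b * b)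
  square = solve-∀

O^I-components : ∀ x → O^I x → ∃₂ λ p s → R x ≡ + 1 + p * + 4 × I x ≡ s * + 2
O^I-components (a + b i) (2∣a+b-1 , 4∣a-1)
  with ℤ.∣ᵤ⇒∣ {+ 2} {a + b - + 1} 2∣a+b-1 | ℤ.∣ᵤ⇒∣ {+ 4} {a - + 1} 4∣a-1
... | ℤ.divides q a+b-1≡2q | ℤ.divides p a-1≡4p =
  p , q - p * + 2 , trans (split-a a) (cong (_+_ (+ 1)) a-1≡4p)
                  , trans (split-b a b) (trans (cong₂ _-_ a+b-1≡2q a-1≡4p) (factor q p))
  where
  split-a : ∀ a → a ≡ + 1 + (a - + 1)
  split-a = solve-∀
  split-b : ∀ a b → b ≡ (a + b - + 1) - (a - + 1)
  split-b = solve-∀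
  factor : ∀ q p → q * + 2 - p * + 4 ≡ (q - p * + 2) * + 2
  factor = solve-∀

O^I-square : ∀ x → O^I x → R (x ⊗ x) ≡₄ + 1
O^I-square x x∈O^I with O^I-components x x∈O^I
... | p , s , Rx≡1+4p , Ix≡2s =
  mod4 (+ 2 * p + + 4 * p * p - s * s)
       (trans (cong₂ (λ a b → a * a - b * b) Rx≡1+4p Ix≡2s) (odd²-even² p s))
  where
  odd²-even² : ∀ p s → (+ 1 + p * + 4) * (+ 1 + p * + 4) - (s * + 2) * (s * + 2)
                       ≡ + 1 + (+ 2 * p + + 4 * p * p - s * s) * + 4
  odd²-even² = solve-∀

1+i²∣⇒R-𝕚-square≡₄0 : ∀ {β} → (1+i ^ 2) ∣ β → R (𝕚 ⊗ (β ⊗ β)) ≡₄ + 0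
1+i²∣⇒R-𝕚-square≡₄0 (c + d i , refl) =
  mod4 (+ 2 * c * d) (trans (R-𝕚⊗ (β ⊗ β)) (eight-cd c d))
  where
  β : ℤ[i]
  β = (1+i ^ 2) ⊗ (c + d i)
  -- (1+i)² computes to 2i, so β unfolds to (0·c − 2d) + (0·d + 2c)i.
  eight-cd : ∀ c d → - ((+ 0 * c - + 2 * d) * (+ 0 * d + + 2 * c) + (+ 0 * d + + 2 * c) * (+ 0 * c - + 2 * d))
                     ≡ + 0 + (+ 2 * c * d) * + 4
  eight-cd = solve-∀

R-square-𝟙⊗-O^I : ∀ x → O^I x → R ((𝟙 ⊗ x) ⊗ (𝟙 ⊗ x)) ≡₄ + 1
R-square-𝟙⊗-O^I x x∈O^I = subst (_≡₄ + 1) (sym (R-square-𝟙⊗ x)) (O^I-square x x∈O^I)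

R-square-𝕚⊗-O^I : ∀ x → O^I x → R ((𝕚 ⊗ x) ⊗ (𝕚 ⊗ x)) ≡₄ - + 1
R-square-𝕚⊗-O^I x x∈O^I = subst (_≡₄ - + 1) (sym (R-square-𝕚⊗ x)) (≡₄-neg (O^I-square x x∈O^I))

lemma4p8 : (α β γ : ℤ[i]) →
    (α ⊗ α) ⊕ (𝕚 ⊗ (β ⊗ β)) ⊕ (γ ⊗ γ) ≡ 𝟘 →
    α ⊗ β ⊗ γ ≢ 𝟘 →
    GcdInU α β γ →
    (1+i ^ 2) ∣ β →
    (m n l k : ℕ) → m ≤ 1 → n ≤ 1 → l ≤ 1 →
    (α' β' γ' : ℤ[i]) → O^I α' → O^I β' → O^I γ' →
    α ≡ (𝕚 ^ m) ⊗ α' →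
    β ≡ (𝕚 ^ n) ⊗ (1+i ^ (2 +ℕ k)) ⊗ β' →
    γ ≡ (𝕚 ^ l) ⊗ γ' →
    (m +ℕ l) % 2 ≡ 1
lemma4p8 _ _ _ sum≡0 _ _ 2∣β _ _ _ _ m≤1 _ l≤1 α' _ γ' α'∈O^I _ γ'∈O^I refl _ refl
  with m≤1 | l≤1
... | z≤n     | s≤s z≤n = refl
... | s≤s z≤n | z≤n     = refl
... | z≤n     | z≤n     =
  ⊥-elim (0≢₄2 (subst (_≡₄ + 2) (cong R sum≡0)
    (≡₄-+ (≡₄-+ (R-square-𝟙⊗-O^I α' α'∈O^I) (1+i²∣⇒R-𝕚-square≡₄0 2∣β))
          (R-square-𝟙⊗-O^I γ' γ'∈O^I))))
... | s≤s z≤n | s≤s z≤n =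
  ⊥-elim (0≢₄-2 (subst (_≡₄ - + 2) (cong R sum≡0)
    (≡₄-+ (≡₄-+ (R-square-𝕚⊗-O^I α' α'∈O^I) (1+i²∣⇒R-𝕚-square≡₄0 2∣β))
          (R-square-𝕚⊗-O^I γ' γ'∈O^I))))
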